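{- Let $N = 2m$ with $m \in \mathbb{N}$, $m \ge 3$. Let $G$ be any network on $N$ nodes constructed as follows: the nodes are split into two halves $A$ and $B$ of $N/2$ nodes each; (i) all pairs of nodes within $A$ are linked and all pairs within $B$ are linked; (ii) each node of $A$ is linked to exactly two nodes of $B$ and each node of $B$ is linked to exactly two nodes of $A$, in such a way that for every integer $n$ with $1 \le n < N/2$, there do not exist a set $S$ of $n$ nodes in one half and a set $T$ of $n$ nodes in the other half such that every neighbour in the other half of every node of $S$ lies in $T$; there are no other links. Then $G$ is $N/2$-robust and has the minimum number of links among all $N/2$-robust networks on $N$ nodes.
   Context: A network is a finite simple undirected graph; links are edges. For an integer $N_f$, a network $G$ is $N_f$-robust if for every set $S$ of $N_f$ nodes of $G$, the network obtained by deleting the nodes of $S$ and their incident links is connected. -}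

module Defs where

open import Data.Nat using (ℕ; _+_; _<ᵇ_)
open import Data.Bool using (Bool; true; false; _∧_; not)
open import Data.Fin using (Fin; toℕ)
open import Data.Fin.Subset using (Subset; _∈_; _∉_; ∣_∣)
open import Data.Vec using (tabulate)
open import Data.List using (map; allFin)
open import Data.Nat.ListAction using (sum)
open import Relation.Binary.PropositionalEquality using (_≡_)

record Graph (n : ℕ) : Set where
  field
    adj    : Fin n → Fin n → Bool
    sym    : ∀ i j → adj i j ≡ adj j i
    irrefl : ∀ i → adj i i ≡ false
open Graph public

count : {n : ℕ} → (Fin n → Bool) → ℕ
count p = ∣ tabulate p ∣

links : {n : ℕ} → Graph n → ℕ
links {n} G = sum (map (λ i → count (λ j → (toℕ i <ᵇ toℕ j) ∧ adj G i j)) (allFin n))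

-- Walks in G using only intermediate/terminal nodes outside S
data Reach {n : ℕ} (G : Graph n) (S : Subset n) : Fin n → Fin n → Set where
  here : ∀ {u} → Reach G S u u
  step : ∀ {u v w} → adj G u v ≡ true → v ∉ S → Reach G S v w → Reach G S u w

ConnectedAfterDeleting : {n : ℕ} → Graph n → Subset n → Set
ConnectedAfterDeleting G S = ∀ u v → u ∉ S → v ∉ S → Reach G S u v

Robust : {n : ℕ} → ℕ → Graph n → Set
Robust k G = ∀ (S : Subset _) → ∣ S ∣ ≡ k → ConnectedAfterDeleting G S

{-# OPTIONS --safe #-}
module Submission where

-- Deleting m of the 2m nodes of G leaves two surviving nodes u, v either in
-- the same half, where they are linked, or in different halves, say u ∈ A and
-- v ∈ B. The survivors X of A are exactly as many as the deleted nodes T of B,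
-- and fewer than m because v survives, so by condition (ii) some s ∈ X has a
-- neighbour t ∈ B outside T, giving the path u – s – t – v.
-- Every node of G has degree (m - 1) + 2 = m + 1. In an m-robust network on 2m
-- nodes every node v has degree at least m + 1: otherwise the neighbours of v,
-- padded to m nodes avoiding v and a non-neighbour w, separate v from w.
-- Summing degrees (handshake lemma) compares the numbers of links.

open import Defs
open import Data.Nat using (ℕ; zero; suc; _+_; _*_; _∸_; _≤_; _<_; _<ᵇ_; z≤n; s≤s⁻¹; _≤?_)
open import Data.Nat.Properties
  using ( +-suc; +-identityʳ; +-comm; +-cancelˡ-≡; +-mono-≤; +-monoˡ-≤; +-mono-≤-<; *-cancelˡ-≤
        ; ≤-trans; ≤-<-trans; ≤-reflexive; ≤-antisym; n≤1+n; ≮⇒≥; ≰⇒>; <⇒≢; <-asym; <ᵇ⇒<; <⇒<ᵇ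
        ; m+n∸m≡n; m<n⇒0<n∸m; ∸-monoˡ-≤; +-0-commutativeMonoid; module ≤-Reasoning )
open import Data.Bool using (Bool; true; false; not; _∧_; _xor_; T)
open import Data.Bool.Properties
  using (not-injective; not-¬; ¬-not; not-distribʳ-xor; xor-same; T-≡) renaming (_≟_ to _≟ᵇ_)
open import Data.Fin using (Fin; zero; suc; toℕ)
open import Data.Fin.Properties using (_≟_; any?; toℕ-injective)
open import Data.Fin.Subset
open import Data.Fin.Subset.Properties
open import Data.Product using (∃; ∃₂; _×_; _,_; proj₁; proj₂)
open import Data.Vec using ([]; _∷_; tabulate; here)
open import Data.Vec.Properties using ([]=⇒lookup; lookup⇒[]=; lookup∘tabulate; tabulate-∘)
import Data.List as List using (map; tabulate)
import Data.Nat.ListAction as List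
open import Algebra.Properties.CommutativeMonoid.Sum +-0-commutativeMonoid
  using (sum; sum-syntax; sum-cong-≗; ∑-distrib-+; ∑-comm)
open import Function using (_∘_; id; Equivalence)
open import Relation.Binary.PropositionalEquality as ≡ using (_≡_; _≢_; refl; cong; cong₂; subst; module ≡-Reasoning)
open import Relation.Nullary using (¬_; yes; no; contradiction; _×-dec_)

private variable
  A : Set
  n k m r : ℕ
  h : Bool
  x u v w : Fin n
  p q P S : Subset n
  G : Graph n

∈-tabulate⁺ : ∀ (f : Fin n → Bool) → f x ≡ true → x ∈ tabulate f
∈-tabulate⁺ {x = x} f fx = lookup⇒[]= x _ (≡.trans (lookup∘tabulate f x) fx)

∈-tabulate⁻ : ∀ (f : Fin n → Bool) → x ∈ tabulate f → f x ≡ true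
∈-tabulate⁻ {x = x} f x∈ = ≡.trans (≡.sym (lookup∘tabulate f x)) ([]=⇒lookup x∈)

∣p∩q∣+∣p∩∁q∣≡∣p∣ : ∀ (p q : Subset n) → ∣ p ∩ q ∣ + ∣ p ∩ ∁ q ∣ ≡ ∣ p ∣
∣p∩q∣+∣p∩∁q∣≡∣p∣ []            []            = refl
∣p∩q∣+∣p∩∁q∣≡∣p∣ (outside ∷ p) (_ ∷ q)       = ∣p∩q∣+∣p∩∁q∣≡∣p∣ p q
∣p∩q∣+∣p∩∁q∣≡∣p∣ (inside  ∷ p) (inside  ∷ q) = cong suc (∣p∩q∣+∣p∩∁q∣≡∣p∣ p q)
∣p∩q∣+∣p∩∁q∣≡∣p∣ (inside  ∷ p) (outside ∷ q) =
  ≡.trans (+-suc ∣ p ∩ q ∣ _) (cong suc (∣p∩q∣+∣p∩∁q∣≡∣p∣ p q))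

p⊆q∧x∉p⇒∣p∣<∣q∣ : p ⊆ q → x ∈ q → x ∉ p → ∣ p ∣ < ∣ q ∣
p⊆q∧x∉p⇒∣p∣<∣q∣ {x = x} p⊆q x∈q x∉p =
  ≤-<-trans (p⊆q⇒∣p∣≤∣q∣ p⊆q-x) (x∈p⇒∣p-x∣<∣p∣ x∈q)
  where
  p⊆q-x : _ ⊆ _ - x
  p⊆q-x y∈p = x∈p∧x≢y⇒x∈p-y (p⊆q y∈p) λ { refl → x∉p y∈p }

x∈p⇒0<∣p∣ : x ∈ p → 0 < ∣ p ∣
x∈p⇒0<∣p∣ x∈p = ≤-<-trans z≤n (x∈p⇒∣p-x∣<∣p∣ x∈p)

0<∣p∣⇒Nonempty : ∀ (p : Subset n) → 0 < ∣ p ∣ → Nonempty p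
0<∣p∣⇒Nonempty {n} p 0<∣p∣ with nonempty? p
... | yes ne = ne
... | no ¬ne = contradiction (≡.trans (cong ∣_∣ (Empty-unique ¬ne)) (∣⊥∣≡0 n)) (<⇒≢ 0<∣p∣ ∘ ≡.sym)

∣p∣<∣q∣⇒∃∈q∖p : ∀ (p q : Subset n) → ∣ p ∣ < ∣ q ∣ → ∃ λ x → x ∈ q ∩ ∁ p
∣p∣<∣q∣⇒∃∈q∖p p q ∣p∣<∣q∣ = 0<∣p∣⇒Nonempty (q ∩ ∁ p) (subst (0 <_) ∣q∩∁p∣≡ 0<∣q∣∸∣q∩p∣)
  where
  ∣q∩∁p∣≡ : ∣ q ∣ ∸ ∣ q ∩ p ∣ ≡ ∣ q ∩ ∁ p ∣
  ∣q∩∁p∣≡ = ≡.trans (cong (_∸ ∣ q ∩ p ∣) (≡.sym (∣p∩q∣+∣p∩∁q∣≡∣p∣ q p))) (m+n∸m≡n ∣ q ∩ p ∣ _)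
  0<∣q∣∸∣q∩p∣ : 0 < ∣ q ∣ ∸ ∣ q ∩ p ∣
  0<∣q∣∸∣q∩p∣ = m<n⇒0<n∸m (≤-<-trans (∣p∩q∣≤∣q∣ q p) ∣p∣<∣q∣)

∣p∣≤1+∣p∩∁⁅x⁆∣ : ∀ (p : Subset n) x → ∣ p ∣ ≤ suc ∣ p ∩ ∁ ⁅ x ⁆ ∣
∣p∣≤1+∣p∩∁⁅x⁆∣ p x = begin
  ∣ p ∣                            ≡⟨ ≡.sym (∣p∩q∣+∣p∩∁q∣≡∣p∣ p ⁅ x ⁆) ⟩
  ∣ p ∩ ⁅ x ⁆ ∣ + ∣ p ∩ ∁ ⁅ x ⁆ ∣  ≤⟨ +-monoˡ-≤ _ (≤-trans (∣p∩q∣≤∣q∣ p ⁅ x ⁆) (≤-reflexive (∣⁅x⁆∣≡1 x))) ⟩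
  suc ∣ p ∩ ∁ ⁅ x ⁆ ∣              ∎
  where open ≤-Reasoning

∣∁⁅x⁆∣≡n∸1 : ∀ (x : Fin n) → ∣ ∁ ⁅ x ⁆ ∣ ≡ n ∸ 1
∣∁⁅x⁆∣≡n∸1 {n} x = ≡.trans (∣∁p∣≡n∸∣p∣ ⁅ x ⁆) (cong (n ∸_) (∣⁅x⁆∣≡1 x))

⊆-interpolate : p ⊆ q → ∣ p ∣ ≤ r → r ≤ ∣ q ∣ → ∃ λ s → p ⊆ s × s ⊆ q × ∣ s ∣ ≡ r
⊆-interpolate {p = []} {[]} _ _ z≤n = [] , (λ ()) , (λ ()) , refl
⊆-interpolate {p = inside ∷ p} {outside ∷ q} p⊆q _ _ = contradiction (p⊆q here) λ ()
⊆-interpolate {p = outside ∷ p} {outside ∷ q} p⊆q ∣p∣≤r r≤∣q∣ =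
  let s , p⊆s , s⊆q , ∣s∣≡r = ⊆-interpolate (drop-∷-⊆ p⊆q) ∣p∣≤r r≤∣q∣
  in outside ∷ s , s⊆s p⊆s , s⊆s s⊆q , ∣s∣≡r
⊆-interpolate {p = inside ∷ p} {inside ∷ q} {suc r} p⊆q ∣p∣≤r r≤∣q∣ =
  let s , p⊆s , s⊆q , ∣s∣≡r = ⊆-interpolate (drop-∷-⊆ p⊆q) (s≤s⁻¹ ∣p∣≤r) (s≤s⁻¹ r≤∣q∣)
  in inside ∷ s , s⊆s p⊆s , s⊆s s⊆q , cong suc ∣s∣≡r
⊆-interpolate {p = outside ∷ p} {inside ∷ q} {r} p⊆q ∣p∣≤r r≤1+∣q∣ with r ≤? ∣ q ∣
... | yes r≤∣q∣ =
  let s , p⊆s , s⊆q , ∣s∣≡r = ⊆-interpolate (drop-∷-⊆ p⊆q) ∣p∣≤r r≤∣q∣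
  in outside ∷ s , s⊆s p⊆s , out⊆ s⊆q , ∣s∣≡r
... | no r≰∣q∣ = inside ∷ q , out⊆ (drop-∷-⊆ p⊆q) , ⊆-refl , ≤-antisym (≰⇒> r≰∣q∣) r≤1+∣q∣

-- Degrees and the handshake lemma

neighbours : Graph n → Fin n → Subset n
neighbours G u = tabulate (adj G u)

degree : Graph n → Fin n → ℕ
degree G u = ∣ neighbours G u ∣

indicator : Bool → ℕ
indicator true  = 1
indicator false = 0

count≡∑ : ∀ (f : Fin n → Bool) → count f ≡ ∑[ i < n ] indicator (f i)
count≡∑ {zero}  f = refl
count≡∑ {suc n} f with f zero
... | true  = cong suc (count≡∑ (f ∘ suc))
... | false = count≡∑ (f ∘ suc)

sum-map-tabulate : ∀ (f : A → ℕ) (g : Fin n → A)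
  → List.sum (List.map f (List.tabulate g)) ≡ ∑[ i < n ] f (g i)
sum-map-tabulate {n = zero}  f g = refl
sum-map-tabulate {n = suc n} f g = cong (f (g zero) +_) (sum-map-tabulate f (g ∘ suc))

∑-mono-≤ : ∀ {f g : Fin n → ℕ} → (∀ i → f i ≤ g i) → ∑[ i < n ] f i ≤ ∑[ i < n ] g i
∑-mono-≤ {zero}  _   = z≤n
∑-mono-≤ {suc n} f≤g = +-mono-≤ (f≤g zero) (∑-mono-≤ (f≤g ∘ suc))

orientations : ∀ (G : Graph n) i j
  → indicator ((toℕ i <ᵇ toℕ j) ∧ adj G i j) + indicator ((toℕ j <ᵇ toℕ i) ∧ adj G j i)
    ≡ indicator (adj G i j)
orientations G i j rewrite Graph.sym G j i with toℕ i <ᵇ toℕ j in i≺j | toℕ j <ᵇ toℕ i in j≺i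
... | true  | true  = contradiction (<ᵇ⇒< (toℕ j) (toℕ i) (Equivalence.from T-≡ j≺i))
                        (<-asym (<ᵇ⇒< (toℕ i) (toℕ j) (Equivalence.from T-≡ i≺j)))
... | true  | false = +-identityʳ _
... | false | true  = refl
... | false | false with toℕ-injective {i = i} {j} (≤-antisym (≮⇒≥ (subst T j≺i ∘ <⇒<ᵇ)) (≮⇒≥ (subst T i≺j ∘ <⇒<ᵇ)))
...   | refl = cong indicator (≡.sym (irrefl G i))

handshake : ∀ (G : Graph n) → ∑[ i < n ] degree G i ≡ 2 * links G
handshake {n} G = begin
  ∑[ i < n ] degree G i                                ≡⟨ sum-cong-≗ (λ i → count≡∑ (adj G i)) ⟩
  ∑[ i < n ] ∑[ j < n ] indicator (adj G i j)          ≡⟨ sum-cong-≗ (λ i → ≡.sym (sum-cong-≗ (orientations G i))) ⟩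
  ∑[ i < n ] ∑[ j < n ] (up i j + up j i)              ≡⟨ sum-cong-≗ (λ i → ∑-distrib-+ (up i) (λ j → up j i)) ⟩
  ∑[ i < n ] (∑[ j < n ] up i j + ∑[ j < n ] up j i)   ≡⟨ ∑-distrib-+ (λ i → ∑[ j < n ] up i j) _ ⟩
  L + ∑[ i < n ] ∑[ j < n ] up j i                     ≡⟨ cong (L +_) (≡.sym (∑-comm up)) ⟩
  L + L                                                ≡⟨ cong (L +_) (≡.sym (+-identityʳ L)) ⟩
  2 * L                                                ≡⟨ cong (2 *_) L≡links ⟩
  2 * links G                                          ∎
  where
  open ≡-Reasoning
  later : Fin n → Fin n → Bool
  later i j = (toℕ i <ᵇ toℕ j) ∧ adj G i j
  up : Fin n → Fin n → ℕ
  up i j = indicator (later i j)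
  L = ∑[ i < n ] ∑[ j < n ] up i j
  L≡links : L ≡ links G
  L≡links = ≡.trans (sum-cong-≗ (λ i → ≡.sym (count≡∑ (later i)))) (≡.sym (sum-map-tabulate (count ∘ later) id))

links-mono : ∀ (G H : Graph n) → (∀ u → degree G u ≤ degree H u) → links G ≤ links H
links-mono {n} G H deg≤ = *-cancelˡ-≤ 2 (begin
  2 * links G            ≡⟨ ≡.sym (handshake G) ⟩
  ∑[ i < n ] degree G i  ≤⟨ ∑-mono-≤ deg≤ ⟩
  ∑[ i < n ] degree H i  ≡⟨ handshake H ⟩
  2 * links H            ∎)
  where open ≤-Reasoning

reach-trans : Reach G S u v → Reach G S v w → Reach G S u w
reach-trans here          r′ = r′
reach-trans (step e v∉ r) r′ = step e v∉ (reach-trans r r′)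

reach-first-step : Reach G S u w → u ≢ w → ∃ λ x → adj G u x ≡ true × x ∉ S
reach-first-step here                   u≢u = contradiction refl u≢u
reach-first-step (step {v = x} e x∉S _) _   = x , e , x∉S

-- Minimum degree of a robust network

isolating-set : 2 + k ≤ n → ∀ (G : Graph n) {v w} → v ≢ w → w ∉ neighbours G v → degree G v ≤ k
  → ∃ λ S → ∣ S ∣ ≡ k × v ∉ S × w ∉ S × neighbours G v ⊆ S
isolating-set {k} {n} 2+k≤n G {v} {w} v≢w w∉N d≤k =
  let S , N⊆S , S⊆Q , ∣S∣≡k = ⊆-interpolate N⊆Q d≤k k≤∣Q∣
  in S , ∣S∣≡k , (λ v∈S → avoids v (proj₁ (x∈p∩q⁻ _ _ (S⊆Q v∈S))))
               , (λ w∈S → avoids w (proj₂ (x∈p∩q⁻ _ _ (S⊆Q w∈S)))) , N⊆S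
  where
  Q = ∁ ⁅ v ⁆ ∩ ∁ ⁅ w ⁆

  avoids : ∀ x → x ∉ ∁ ⁅ x ⁆
  avoids x x∈ = x∈∁p⇒x∉p x∈ (x∈⁅x⁆ x)

  N⊆Q : neighbours G v ⊆ Q
  N⊆Q {x} x∈N = x∈p∩q⁺ (x∉p⇒x∈∁p x∉⁅v⁆ , x∉p⇒x∈∁p x∉⁅w⁆)
    where
    x∉⁅v⁆ : x ∉ ⁅ v ⁆
    x∉⁅v⁆ x∈⁅v⁆ with x∈⁅y⁆⇒x≡y v x∈⁅v⁆
    ... | refl = not-¬ (irrefl G v) (∈-tabulate⁻ (adj G v) x∈N)
    x∉⁅w⁆ : x ∉ ⁅ w ⁆
    x∉⁅w⁆ x∈⁅w⁆ with x∈⁅y⁆⇒x≡y w x∈⁅w⁆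
    ... | refl = w∉N x∈N

  k≤∣Q∣ : k ≤ ∣ Q ∣
  k≤∣Q∣ = s≤s⁻¹ (begin
    suc k        ≤⟨ ∸-monoˡ-≤ 1 2+k≤n ⟩
    n ∸ 1        ≡⟨ ≡.sym (∣∁⁅x⁆∣≡n∸1 v) ⟩
    ∣ ∁ ⁅ v ⁆ ∣  ≤⟨ ∣p∣≤1+∣p∩∁⁅x⁆∣ (∁ ⁅ v ⁆) w ⟩
    suc ∣ Q ∣    ∎)
    where open ≤-Reasoning

robust⇒degree : ∀ {H : Graph n} → Robust k H → 2 + k ≤ n → ∀ v → k < degree H v
robust⇒degree {n} {k} {H} robust 2+k≤n v with suc k ≤? degree H v
... | yes k<d = k<d
... | no k≮d =
  let d≤k = ≮⇒≥ k≮d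
      w , w∈R∖N = ∣p∣<∣q∣⇒∃∈q∖p (neighbours H v) (∁ ⁅ v ⁆)
                    (≤-<-trans d≤k (subst (k <_) (≡.sym (∣∁⁅x⁆∣≡n∸1 v)) (∸-monoˡ-≤ 1 2+k≤n)))
      w∈R , w∉N = x∈p∩q⁻ (∁ ⁅ v ⁆) _ w∈R∖N
      v≢w = x∉⁅y⁆⇒x≢y (x∈∁p⇒x∉p w∈R) ∘ ≡.sym
      S , ∣S∣≡k , v∉S , w∉S , N⊆S = isolating-set 2+k≤n H v≢w (x∈∁p⇒x∉p w∉N) d≤k
      x , vx , x∉S = reach-first-step (robust S ∣S∣≡k v w v∉S w∉S) v≢w
  in contradiction (N⊆S (∈-tabulate⁺ (adj H v) vx)) x∉S

-- Robustness of two linked cliques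

IsClique : Graph n → Subset n → Set
IsClique G P = ∀ {u v} → u ∈ P → v ∈ P → u ≢ v → adj G u v ≡ true

clique-reach : IsClique G P → u ∈ P → v ∈ P → v ∉ S → Reach G S u v
clique-reach {u = u} {v} clique u∈P v∈P v∉S with u ≟ v
... | yes refl = here
... | no u≢v  = step (clique u∈P v∈P u≢v) v∉S here

Expanding : Graph n → Subset n → Subset n → ℕ → Set
Expanding G P Q k = ∀ {S T} → S ⊆ P → T ⊆ Q → ∣ S ∣ ≡ ∣ T ∣ → 0 < ∣ S ∣ → ∣ S ∣ < k
  → ∃₂ λ s t → s ∈ S × t ∈ Q ∩ ∁ T × adj G s t ≡ true

link-leaving : ∀ (G : Graph n) S Q T → ¬ (∀ s t → s ∈ S → adj G s t ≡ true → t ∈ Q → t ∈ T)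
  → ∃₂ λ s t → s ∈ S × t ∈ Q ∩ ∁ T × adj G s t ≡ true
link-leaving G S Q T ¬closed
  with any? (λ s → any? (λ t → s ∈? S ×-dec t ∈? Q ∩ ∁ T ×-dec adj G s t ≟ᵇ true))
... | yes (s , t , link) = s , t , link
... | no none = contradiction closed ¬closed
  where
  closed : ∀ s t → s ∈ S → adj G s t ≡ true → t ∈ Q → t ∈ T
  closed s t s∈S st t∈Q with t ∈? T
  ... | yes t∈T = t∈T
  ... | no t∉T  = contradiction (s , t , s∈S , x∈p∩q⁺ (t∈Q , x∉p⇒x∈∁p t∉T) , st) none

reach-across : IsClique G P → IsClique G (∁ P) → Expanding G P (∁ P) k → ∣ ∁ P ∣ ≡ k
  → ∣ S ∣ ≡ ∣ P ∣ → u ∈ P ∩ ∁ S → v ∈ ∁ P ∩ ∁ S → Reach G S u v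
reach-across {G = G} {P} {k} {S} {u} {v} cliqueP clique∁P expanding ∣∁P∣≡k ∣S∣≡∣P∣ u∈P∖S v∈∁P∖S =
  walk (expanding (p∩q⊆p P (∁ S)) (p∩q⊆q S (∁ P)) ∣P∖S∣≡∣S∩∁P∣ (x∈p⇒0<∣p∣ u∈P∖S) ∣P∖S∣<k)
  where
  ∣P∖S∣≡∣S∩∁P∣ : ∣ P ∩ ∁ S ∣ ≡ ∣ S ∩ ∁ P ∣
  ∣P∖S∣≡∣S∩∁P∣ = +-cancelˡ-≡ ∣ P ∩ S ∣ _ _ (begin
    ∣ P ∩ S ∣ + ∣ P ∩ ∁ S ∣ ≡⟨ ∣p∩q∣+∣p∩∁q∣≡∣p∣ P S ⟩
    ∣ P ∣                   ≡⟨ ≡.sym ∣S∣≡∣P∣ ⟩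
    ∣ S ∣                   ≡⟨ ≡.sym (∣p∩q∣+∣p∩∁q∣≡∣p∣ S P) ⟩
    ∣ S ∩ P ∣ + ∣ S ∩ ∁ P ∣ ≡⟨ cong (λ X → ∣ X ∣ + ∣ S ∩ ∁ P ∣) (∩-comm S P) ⟩
    ∣ P ∩ S ∣ + ∣ S ∩ ∁ P ∣ ∎)
    where open ≡-Reasoning

  v∈∁P = proj₁ (x∈p∩q⁻ (∁ P) (∁ S) v∈∁P∖S)
  v∉S = x∈∁p⇒x∉p (proj₂ (x∈p∩q⁻ (∁ P) (∁ S) v∈∁P∖S))

  ∣P∖S∣<k : ∣ P ∩ ∁ S ∣ < k
  ∣P∖S∣<k = begin-strict
    ∣ P ∩ ∁ S ∣ ≡⟨ ∣P∖S∣≡∣S∩∁P∣ ⟩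
    ∣ S ∩ ∁ P ∣ <⟨ p⊆q∧x∉p⇒∣p∣<∣q∣ (p∩q⊆q S (∁ P)) v∈∁P (v∉S ∘ proj₁ ∘ x∈p∩q⁻ S (∁ P)) ⟩
    ∣ ∁ P ∣     ≡⟨ ∣∁P∣≡k ⟩
    k           ∎
    where open ≤-Reasoning

  walk : (∃₂ λ s t → s ∈ P ∩ ∁ S × t ∈ ∁ P ∩ ∁ (S ∩ ∁ P) × adj G s t ≡ true) → Reach G S u v
  walk (s , t , s∈P∖S , t∈∁P∖T , st) =
    reach-trans (clique-reach cliqueP (proj₁ (x∈p∩q⁻ P (∁ S) u∈P∖S)) s∈P s∉S)
      (step st t∉S (clique-reach clique∁P t∈∁P v∈∁P v∉S))
    where
    s∈P = proj₁ (x∈p∩q⁻ P (∁ S) s∈P∖S)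
    s∉S = x∈∁p⇒x∉p (proj₂ (x∈p∩q⁻ P (∁ S) s∈P∖S))
    t∈∁P = proj₁ (x∈p∩q⁻ (∁ P) _ t∈∁P∖T)
    t∉S : t ∉ S
    t∉S t∈S = x∈∁p⇒x∉p (proj₂ (x∈p∩q⁻ (∁ P) _ t∈∁P∖T)) (x∈p∩q⁺ (t∈S , t∈∁P))

NoTrappedPair : ℕ → Graph n → (Fin n → Bool) → Set
NoTrappedPair {n} m G side = ∀ (k : ℕ) → 1 ≤ k → k < m → ∀ (h : Bool) (S T : Subset n)
  → ∣ S ∣ ≡ k → ∣ T ∣ ≡ k
  → (∀ s → s ∈ S → side s ≡ h) → (∀ t → t ∈ T → side t ≡ not h)
  → ¬ (∀ s t → s ∈ S → adj G s t ≡ true → side t ≡ not h → t ∈ T)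

module Halves (side : Fin n → Bool) where

  half : Bool → Subset n
  half true  = tabulate side
  half false = tabulate (not ∘ side)

  ∈-half⁺ : side x ≡ h → x ∈ half h
  ∈-half⁺ {h = true}  sx≡h = ∈-tabulate⁺ side sx≡h
  ∈-half⁺ {h = false} sx≡h = ∈-tabulate⁺ (not ∘ side) (cong not sx≡h)

  ∈-half⁻ : x ∈ half h → side x ≡ h
  ∈-half⁻ {h = true}  x∈ = ∈-tabulate⁻ side x∈
  ∈-half⁻ {h = false} x∈ = not-injective (∈-tabulate⁻ (not ∘ side) x∈)

  ∈-∁half⁺ : side x ≡ not h → x ∈ ∁ (half h)
  ∈-∁half⁺ sx≡¬h = x∉p⇒x∈∁p λ x∈ → not-¬ (∈-half⁻ x∈) sx≡¬h

  ∈-∁half⁻ : x ∈ ∁ (half h) → side x ≡ not h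
  ∈-∁half⁻ x∈ = ¬-not λ sx≡h → x∈∁p⇒x∉p x∈ (∈-half⁺ sx≡h)

  one-sided-clique : (∀ u v → u ≢ v → side u ≡ side v → adj G u v ≡ true)
    → (∀ {x} → x ∈ P → side x ≡ h) → IsClique G P
  one-sided-clique linked one-sided u∈ v∈ u≢v =
    linked _ _ u≢v (≡.trans (one-sided u∈) (≡.sym (one-sided v∈)))

  no-trap⇒expanding : NoTrappedPair m G side → ∀ h → Expanding G (half h) (∁ (half h)) m
  no-trap⇒expanding {G = G} no-trap h {S} {T} S⊆ T⊆ ∣S∣≡∣T∣ 0<∣S∣ ∣S∣<m =
    link-leaving G S (∁ (half h)) T λ closed →
      no-trap ∣ S ∣ 0<∣S∣ ∣S∣<m h S T refl (≡.sym ∣S∣≡∣T∣)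
        (λ _ s∈S → ∈-half⁻ (S⊆ s∈S)) (λ _ t∈T → ∈-∁half⁻ (T⊆ t∈T))
        (λ s t s∈S st side-t → closed s t s∈S st (∈-∁half⁺ side-t))

module _ {m} (G : Graph (2 * m)) {side : Fin (2 * m) → Bool} (count-side : count side ≡ m) where
  open Halves side

  private
    2m∸m≡m : 2 * m ∸ m ≡ m
    2m∸m≡m = ≡.trans (cong (λ k → m + k ∸ m) (+-identityʳ m)) (m+n∸m≡n m m)

  ∣half∣≡m : ∀ h → ∣ half h ∣ ≡ m
  ∣half∣≡m true  = count-side
  ∣half∣≡m false = begin
    ∣ tabulate (not ∘ side) ∣  ≡⟨ cong ∣_∣ (tabulate-∘ not side) ⟩
    ∣ ∁ (tabulate side) ∣      ≡⟨ ∣∁p∣≡n∸∣p∣ (tabulate side) ⟩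
    2 * m ∸ count side         ≡⟨ cong (2 * m ∸_) count-side ⟩
    2 * m ∸ m                  ≡⟨ 2m∸m≡m ⟩
    m                          ∎
    where open ≡-Reasoning

  ∣∁half∣≡m : ∀ h → ∣ ∁ (half h) ∣ ≡ m
  ∣∁half∣≡m h = ≡.trans (∣∁p∣≡n∸∣p∣ (half h)) (≡.trans (cong (2 * m ∸_) (∣half∣≡m h)) 2m∸m≡m)

  two-clique-robust : (∀ u v → u ≢ v → side u ≡ side v → adj G u v ≡ true)
    → NoTrappedPair m G side → Robust m G
  two-clique-robust linked no-trap S ∣S∣≡m u v u∉S v∉S with side u ≟ᵇ side v
  ... | yes same = clique-reach (one-sided-clique {G = G} linked (∈-half⁻ {h = side u}))
                     (∈-half⁺ refl) (∈-half⁺ (≡.sym same)) v∉S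
  ... | no differ = reach-across
    (one-sided-clique {G = G} linked (∈-half⁻ {h = side u}))
    (one-sided-clique {G = G} linked (∈-∁half⁻ {h = side u}))
    (no-trap⇒expanding {G = G} no-trap (side u)) (∣∁half∣≡m (side u))
    (≡.trans ∣S∣≡m (≡.sym (∣half∣≡m (side u))))
    (x∈p∩q⁺ (∈-half⁺ refl , x∉p⇒x∈∁p u∉S))
    (x∈p∩q⁺ (∈-∁half⁺ (¬-not (differ ∘ ≡.sym)) , x∉p⇒x∈∁p v∉S))

  two-clique-degree : (∀ u → count (λ v → (side u xor side v) ∧ adj G u v) ≡ 2)
    → ∀ u → degree G u ≤ suc m
  two-clique-degree cross-degree u = s≤s⁻¹ (begin-strict
    degree G u                 ≡⟨ ≡.sym (∣p∩q∣+∣p∩∁q∣≡∣p∣ N Own) ⟩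
    ∣ N ∩ Own ∣ + ∣ N ∩ ∁ Own ∣  ≡⟨ +-comm ∣ N ∩ Own ∣ _ ⟩
    ∣ N ∩ ∁ Own ∣ + ∣ N ∩ Own ∣  <⟨ +-mono-≤-< ∣N∩∁Own∣≤2 ∣N∩Own∣<m ⟩
    2 + m                      ∎)
    where
    open ≤-Reasoning
    N = neighbours G u
    Own = half (side u)

    ∣N∩Own∣<m : ∣ N ∩ Own ∣ < m
    ∣N∩Own∣<m = ≤-trans
      (p⊆q∧x∉p⇒∣p∣<∣q∣ (p∩q⊆q N Own) (∈-half⁺ refl)
        (not-¬ (irrefl G u) ∘ ∈-tabulate⁻ (adj G u) ∘ proj₁ ∘ x∈p∩q⁻ N Own))
      (≤-reflexive (∣half∣≡m (side u)))

    N∩∁Own⊆cross : N ∩ ∁ Own ⊆ tabulate (λ v → (side u xor side v) ∧ adj G u v)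
    N∩∁Own⊆cross {v} v∈ = ∈-tabulate⁺ _ (cong₂ _∧_ cross (∈-tabulate⁻ (adj G u) v∈N))
      where
      v∈N = proj₁ (x∈p∩q⁻ N (∁ Own) v∈)
      cross : side u xor side v ≡ true
      cross = ≡.trans (cong (side u xor_) (∈-∁half⁻ (proj₂ (x∈p∩q⁻ N (∁ Own) v∈))))
                (≡.trans (≡.sym (not-distribʳ-xor (side u) (side u))) (cong not (xor-same (side u))))

    ∣N∩∁Own∣≤2 : ∣ N ∩ ∁ Own ∣ ≤ 2
    ∣N∩∁Own∣≤2 = ≤-trans (p⊆q⇒∣p∣≤∣q∣ N∩∁Own⊆cross) (≤-reflexive (cross-degree u))

theorem2 : (m : ℕ) → 3 ≤ m → (G : Graph (2 * m)) → (side : Fin (2 * m) → Bool)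
    → count side ≡ m
    → (∀ u v → u ≢ v → side u ≡ side v → adj G u v ≡ true)
    → (∀ u → count (λ v → (side u xor side v) ∧ adj G u v) ≡ 2)
    → (∀ (n : ℕ) → 1 ≤ n → n < m → ∀ (h : Bool) (S T : Subset (2 * m))
        → ∣ S ∣ ≡ n → ∣ T ∣ ≡ n
        → (∀ s → s ∈ S → side s ≡ h) → (∀ t → t ∈ T → side t ≡ not h)
        → ¬ (∀ s t → s ∈ S → adj G s t ≡ true → side t ≡ not h → t ∈ T))
    → Robust m G × (∀ (H : Graph (2 * m)) → Robust m H → links G ≤ links H)
theorem2 m 3≤m G side count-side linked cross-degree no-trap =
  two-clique-robust G count-side linked no-trap ,
  λ H robust → links-mono G H λ u →
    ≤-trans (two-clique-degree G count-side cross-degree u) (robust⇒degree robust 2+m≤2*m u)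
  where
  2+m≤2*m : 2 + m ≤ 2 * m
  2+m≤2*m = ≤-trans (+-monoˡ-≤ m (≤-trans (n≤1+n 2) 3≤m)) (≤-reflexive (cong (m +_) (≡.sym (+-identityʳ m))))
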